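{- Let $T$ be a binary search tree with $n$ nodes, and consider the following procedure $\mathrm{LeftifyTree}(T)$ with a finger $f$ initially at the root: repeatedly, if $f$ has a right child $r$, move $f$ to $r$ and then rotate at $f$ (i.e., rotate $r$ with its parent); otherwise move $f$ to its left child; stop when $f$ is at a leaf. Then the procedure halts after at most $3n-3$ operations, where each finger move and each rotation counts as one operation. -}

module Defs where

open import Data.Nat using (ℕ; zero; suc; _+_; _<_)
open import Data.List using (List; []; _∷_; _++_)
open import Data.List.Relation.Unary.Linked using (Linked)
open import Data.Maybe using (Maybe; just; nothing)
open import Data.Product using (_×_; _,_)

-- Binary trees with natural-number keys; `leaf` is the empty subtree
-- (a nil pointer), `node l k r` is a node with key k.
data Tree : Set where
  leaf : Tree
  node : Tree → ℕ → Tree → Tree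

size : Tree → ℕ
size leaf = 0
size (node l _ r) = suc (size l + size r)

inorder : Tree → List ℕ
inorder leaf = []
inorder (node l k r) = inorder l ++ (k ∷ inorder r)

IsBST : Tree → Set
IsBST t = Linked _<_ (inorder t)

-- Zipper frames: the path from the finger back to the root.
data Frame : Set where
  wentLeft  : ℕ → Tree → Frame   -- parent key, parent's right subtree
  wentRight : Tree → ℕ → Frame   -- parent's left subtree, parent key

-- Configuration: subtree rooted at the finger, plus the path to the root.
Config : Set
Config = Tree × List Frame

-- Elementary operations (each costs 1).
moveRight : Config → Maybe Config
moveRight (node l k (node rl rk rr) , ctx) = just (node rl rk rr , wentRight l k ∷ ctx)
moveRight _ = nothing

moveLeft : Config → Maybe Config
moveLeft (node (node ll lk lr) k r , ctx) = just (node ll lk lr , wentLeft k r ∷ ctx)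
moveLeft _ = nothing

-- rotate at the finger f: rotate f with its parent (f is a right child here
-- or a left child; both rotation directions are given).  The finger stays on
-- the same node, which moves up one level.
rotateAtFinger : Config → Maybe Config
rotateAtFinger (node a x b , wentRight l k ∷ ctx) = just (node (node l k a) x b , ctx)
rotateAtFinger (node a x b , wentLeft k r ∷ ctx) = just (node a x (node b k r) , ctx)
rotateAtFinger _ = nothing

bindM : {A B : Set} → Maybe A → (A → Maybe B) → Maybe B
bindM nothing _ = nothing
bindM (just a) f = f a

-- One iteration of the loop of LeftifyTree, returning (number of operations, new config),
-- or nothing when the finger is at a leaf (node without children): stop.
leftifyStep : Config → Maybe (ℕ × Config)
leftifyStep c@(node _ _ (node _ _ _) , _) =
  bindM (moveRight c) λ c₁ → bindM (rotateAtFinger c₁) λ c₂ → just (2 , c₂)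
leftifyStep c@(node (node _ _ _) _ leaf , _) =
  bindM (moveLeft c) λ c₁ → just (1 , c₁)
leftifyStep _ = nothing

mapM : {A B : Set} → (A → B) → Maybe A → Maybe B
mapM f nothing = nothing
mapM f (just a) = just (f a)

-- Run LeftifyTree for at most `fuel` loop iterations; returns `just ops`
-- (total operation count) if it halts within the fuel, `nothing` otherwise.
runLeftify : ℕ → Config → Maybe ℕ
runLeftify fuel c with leftifyStep c
... | nothing = just 0
runLeftify zero c | just _ = nothing
runLeftify (suc fuel) c | just (cost , c′) = mapM (cost +_) (runLeftify fuel c′)

-- Let the potential of the subtree at the finger be its size plus twice the
-- number of its nodes off the left spine.  A rotation step costs 2 and moves
-- exactly one node (the finger's right child) onto the left spine, without
-- changing the size; a left move costs 1 and drops the root from the subtree.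
-- So every loop iteration lowers the potential by its cost, and the run ends
-- at a single node, of potential 1.  The total cost is therefore the initial
-- potential minus 1, at most n + 2(n - 1) - 1 = 3n - 3.
module Submission where

open import Defs
open import Data.Nat using (ℕ; zero; suc; _+_; _*_; _∸_; _≤_; pred; z≤n)
open import Data.Nat.Properties
  using (≤-refl; ≤-trans; ≤-pred; n≤1+n; +-monoˡ-≤; +-monoʳ-≤; *-monoʳ-≤; *-distribˡ-∸)
open import Data.Nat.Tactic.RingSolver using (solve-∀)
open import Data.List using (List; []; _∷_)
open import Data.Maybe using (just)
open import Data.Product using (∃-syntax; _×_; _,_)
open import Function using (_∘_)
open import Relation.Binary.PropositionalEquality using (_≡_; refl; sym; trans; cong; subst)

offLeftSpine : Tree → ℕ
offLeftSpine leaf         = 0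
offLeftSpine (node l _ r) = offLeftSpine l + size r

offLeftSpine≤size : ∀ t → offLeftSpine t ≤ size t
offLeftSpine≤size leaf         = z≤n
offLeftSpine≤size (node l _ r) =
  ≤-trans (+-monoˡ-≤ (size r) (offLeftSpine≤size l)) (n≤1+n _)

potential : Tree → ℕ
potential t = size t + 2 * offLeftSpine t

potential-rotate : ∀ a x rl rk rr →
  2 + potential (node (node a x rl) rk rr) ≡ potential (node a x (node rl rk rr))
potential-rotate a x rl rk rr =
  lemma (size a) (size rl) (size rr) (offLeftSpine a)
  where
  lemma : ∀ sa srl srr oa →
    2 + (suc (suc (sa + srl) + srr) + 2 * (oa + srl + srr))
      ≡ suc (sa + suc (srl + srr)) + 2 * (oa + suc (srl + srr))
  lemma = solve-∀

potential-moveLeft : ∀ ll lk lr x →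
  1 + potential (node ll lk lr) ≡ potential (node (node ll lk lr) x leaf)
potential-moveLeft ll lk lr x = lemma (size ll) (size lr) (offLeftSpine ll)
  where
  lemma : ∀ sll slr oll →
    1 + (suc (sll + slr) + 2 * (oll + slr))
      ≡ suc (suc (sll + slr) + 0) + 2 * (oll + slr + 0)
  lemma = solve-∀

-- Since potential (node a x r) is a successor, `pred` is exact here.
runLeftify-cost : ∀ fuel a x r (ctx : List Frame) → potential (node a x r) ≤ fuel →
  runLeftify fuel (node a x r , ctx) ≡ just (pred (potential (node a x r)))
runLeftify-cost fuel    leaf x leaf ctx _ = refl
runLeftify-cost zero    a x (node _ _ _) ctx ()
runLeftify-cost zero    (node _ _ _) x leaf ctx ()
runLeftify-cost (suc k) a x (node rl rk rr) ctx pot≤ =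
  trans (cong (mapM (2 +_)) (runLeftify-cost k (node a x rl) rk rr ctx pot′≤k))
        (cong (just ∘ pred) step)
  where
  step : 2 + potential (node (node a x rl) rk rr) ≡ potential (node a x (node rl rk rr))
  step = potential-rotate a x rl rk rr
  pot′≤k : potential (node (node a x rl) rk rr) ≤ k
  pot′≤k = ≤-trans (n≤1+n _) (≤-pred (subst (_≤ suc k) (sym step) pot≤))
runLeftify-cost (suc k) (node ll lk lr) x leaf ctx pot≤ =
  trans (cong (mapM (1 +_)) (runLeftify-cost k ll lk lr (wentLeft x leaf ∷ ctx) pot′≤k))
        (cong (just ∘ pred) step)
  where
  step : 1 + potential (node ll lk lr) ≡ potential (node (node ll lk lr) x leaf)
  step = potential-moveLeft ll lk lr x
  pot′≤k : potential (node ll lk lr) ≤ k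
  pot′≤k = ≤-pred (subst (_≤ suc k) (sym step) pot≤)

pred-potential≤ : ∀ l k r → pred (potential (node l k r)) ≤ 3 * size (node l k r) ∸ 3
pred-potential≤ l k r =
  subst (pred (potential (node l k r)) ≤_) (*-distribˡ-∸ 3 (suc m) 1)
    (+-monoʳ-≤ m (*-monoʳ-≤ 2 (+-monoˡ-≤ (size r) (offLeftSpine≤size l))))
  where
  m : ℕ
  m = size l + size r

lemma28 : (T : Tree) → IsBST T → 1 ≤ size T →
    ∃[ fuel ] ∃[ ops ] (runLeftify fuel (T , []) ≡ just ops × ops ≤ 3 * size T ∸ 3)
lemma28 (node l k r) _ _ =
  potential T , pred (potential T) ,
  runLeftify-cost (potential T) l k r [] ≤-refl , pred-potential≤ l k r
  where
  T : Tree
  T = node l k r
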